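{- Let $q$ be a non-degenerate quadratic form of dimension at least $2$ over an arbitrary field $F$, let $a\in F$, and let $(x_0,x_1,x_2,x_3,x_0)$ be a cycle of length $4$ in $\mathcal{G}_{q,a}$ with diagonals $d_1=x_2-x_0$ and $d_2=x_3-x_1$. (1) $b_q(d_1,d_2)=0$. Suppose moreover that $\dim(q)=2$ and $a\in F^\ast$. (2) If $\mathrm{char}(F)\ne2$, then $q\cong\langle q(d_1),q(d_2)\rangle$. (3) If $\mathrm{char}(F)=2$, then $d_1=d_2$.
   Context: A quadratic form on a finite-dimensional $F$-vector space $V$ is a map $q:V\to F$ with $q(\lambda x)=\lambda^2q(x)$ such that $b_q(x,y)=q(x+y)-q(x)-q(y)$ is bilinear; non-degenerate means $\{x: b_q(x,y)=0\ \forall y\}=\{0\}$. $\langle c_1,c_2\rangle$ denotes $(x,y)\mapsto c_1x^2+c_2y^2$ and $\cong$ is isometry. The representation graph $\mathcal{G}_{q,a}$ has vertex set $V$, with distinct $x,y$ adjacent iff $q(x-y)=a$. A cycle of length $4$ is a sequence $(x_0,x_1,x_2,x_3,x_0)$ of pairwise distinct vertices with consecutive ones adjacent. -}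

module Defs where

open import Level using (Level) renaming (suc to lsuc)
open import Data.Nat using (ℕ)
open import Data.Fin using (Fin; zero; suc)
open import Data.Product using (Σ; _×_; _,_)
open import Relation.Binary.PropositionalEquality using (_≡_; _≢_)
open import Relation.Nullary using (¬_)
open import Algebra.Structures using (IsCommutativeRing)

record Field (c : Level) : Set (lsuc c) where
  infixl 7 _*_
  infix 8 -_
  infixl 6 _+_
  field
    Carrier           : Set c
    _+_ _*_           : Carrier → Carrier → Carrier
    -_                : Carrier → Carrier
    0# 1#             : Carrier
    isCommutativeRing : IsCommutativeRing _≡_ _+_ _*_ -_ 0# 1#
    0≢1               : 0# ≢ 1#
    inverse           : ∀ x → x ≢ 0# → Σ Carrier (λ y → x * y ≡ 1#)

  infixl 6 _-_
  _-_ : Carrier → Carrier → Carrier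
  x - y = x + (- y)

module FieldDefs {c : Level} (F : Field c) where
  open Field F

  -- the n-dimensional F-vector space F^n (coordinates w.r.t. a basis)
  Vec : ℕ → Set c
  Vec n = Fin n → Carrier

  _≈ᵥ_ : ∀ {n} → Vec n → Vec n → Set c
  x ≈ᵥ y = ∀ i → x i ≡ y i

  0ᵥ : ∀ {n} → Vec n
  0ᵥ _ = 0#

  _+ᵥ_ : ∀ {n} → Vec n → Vec n → Vec n
  (x +ᵥ y) i = x i + y i

  _-ᵥ_ : ∀ {n} → Vec n → Vec n → Vec n
  (x -ᵥ y) i = x i - y i

  _·_ : ∀ {n} → Carrier → Vec n → Vec n
  (λ' · x) i = λ' * x i

  polar : ∀ {n} → (Vec n → Carrier) → Vec n → Vec n → Carrier
  polar q x y = q (x +ᵥ y) - q x - q y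

  record IsQuadraticForm {n : ℕ} (q : Vec n → Carrier) : Set c where
    field
      cong       : ∀ {x y} → x ≈ᵥ y → q x ≡ q y
      homog      : ∀ λ' x → q (λ' · x) ≡ (λ' * λ') * q x
      bil-+ˡ     : ∀ x x' y → polar q (x +ᵥ x') y ≡ polar q x y + polar q x' y
      bil-·ˡ     : ∀ λ' x y → polar q (λ' · x) y ≡ λ' * polar q x y
      bil-+ʳ     : ∀ x y y' → polar q x (y +ᵥ y') ≡ polar q x y + polar q x y'
      bil-·ʳ     : ∀ λ' x y → polar q x (λ' · y) ≡ λ' * polar q x y

  NonDegenerate : ∀ {n} → (Vec n → Carrier) → Set c
  NonDegenerate q = ∀ x → (∀ y → polar q x y ≡ 0#) → x ≈ᵥ 0ᵥ

  Adjacent : ∀ {n} → (Vec n → Carrier) → Carrier → Vec n → Vec n → Set c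
  Adjacent q a x y = (¬ x ≈ᵥ y) × q (x -ᵥ y) ≡ a

  IsCycle4 : ∀ {n} → (Vec n → Carrier) → Carrier → (x₀ x₁ x₂ x₃ : Vec n) → Set c
  IsCycle4 q a x₀ x₁ x₂ x₃ =
    (¬ x₀ ≈ᵥ x₁) × (¬ x₀ ≈ᵥ x₂) × (¬ x₀ ≈ᵥ x₃) ×
    (¬ x₁ ≈ᵥ x₂) × (¬ x₁ ≈ᵥ x₃) × (¬ x₂ ≈ᵥ x₃) ×
    Adjacent q a x₀ x₁ × Adjacent q a x₁ x₂ ×
    Adjacent q a x₂ x₃ × Adjacent q a x₃ x₀

  diag2 : Carrier → Carrier → Vec 2 → Carrier
  diag2 c₁ c₂ v = c₁ * (v zero * v zero) + c₂ * (v (suc zero) * v (suc zero))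

  record IsLinearIso {m n : ℕ} (f : Vec m → Vec n) : Set c where
    field
      cong       : ∀ {x y} → x ≈ᵥ y → f x ≈ᵥ f y
      additive   : ∀ x y → f (x +ᵥ y) ≈ᵥ (f x +ᵥ f y)
      homogen    : ∀ λ' x → f (λ' · x) ≈ᵥ (λ' · f x)
      injective  : ∀ x y → f x ≈ᵥ f y → x ≈ᵥ y
      surjective : ∀ y → Σ (Vec m) (λ x → f x ≈ᵥ y)

  Isometric : ∀ {n m} → (Vec n → Carrier) → (Vec m → Carrier) → Set c
  Isometric {n} {m} q q' =
    Σ (Vec m → Vec n) (λ f → IsLinearIso f × (∀ v → q (f v) ≡ q' v))

{-# OPTIONS --safe #-}
-- (1) Expanding b(x₂ - x₀, x₃ - x₁) bilinearly gives an alternating sum of the four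
-- b(xᵢ, xᵢ₊₁) = q xᵢ + q xᵢ₊₁ - a, which cancels.
--
-- In the plane, b(x, y)² - 4 q(x) q(y) = det(x, y)² · Δ with Δ = b(e₀, e₁)² - 4 q(e₀) q(e₁),
-- and Δ ≠ 0 for non-degenerate q in every characteristic. Hence a diagonal, say
-- x₂ - x₀ = (x₁ - x₀) + (x₂ - x₁), is anisotropic: if it were isotropic it would be orthogonal,
-- hence parallel, to the anisotropic side x₁ - x₀, which forces it to be 0.
-- (2) If 2 ≠ 0, the same identity makes the orthogonal anisotropic diagonals independent,
-- so they are an orthogonal basis in which q is ⟨q(d₁), q(d₂)⟩.
-- (3) If 2 = 0, then b = b(e₀, e₁) · det is alternating, so orthogonal vectors are parallel.
-- The side u = x₂ - x₁ satisfies b(dᵢ, u) = q(dᵢ), so d₁ ∥ d₂ becomes q(d₂) d₁ = q(d₁) d₂;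
-- applying q gives q(d₁) = q(d₂), hence d₁ = d₂.
module Submission where

open import Defs
open import Level using (Level)
open import Data.Nat as ℕ using (ℕ; _≤_)
import Data.Nat.Properties as ℕ
open import Data.Integer as ℤ using (ℤ; -[1+_])
import Data.Integer.Properties as ℤ
open import Data.Fin.Patterns using (0F; 1F)
open import Data.Maybe using (Maybe; just; nothing)
open import Data.Product using (_×_; _,_; proj₁; proj₂)
open import Data.Vec.Functional using ([]; _∷_)
open import Relation.Binary.PropositionalEquality
  using (_≡_; _≢_; refl; sym; trans; cong; cong₂; module ≡-Reasoning)
open import Relation.Nullary using (¬_; yes; no)
open import Algebra.Bundles using (CommutativeRing)
open import Algebra.Solver.Ring.AlmostCommutativeRing
  using (fromCommutativeRing; _-Raw-AlmostCommutative⟶_)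
import Algebra.Solver.Ring as RingSolver

module Scalars {c : Level} (F : Field c) where
  open Field F
  open ≡-Reasoning

  commutativeRing : CommutativeRing c c
  commutativeRing = record { isCommutativeRing = isCommutativeRing }

  open CommutativeRing commutativeRing
    using ( ring; semiring; +-group; +-comm; +-assoc; +-identityˡ; +-identityʳ
          ; *-comm; *-assoc; *-identityˡ; zeroˡ; zeroʳ; -‿inverseʳ)
  open import Algebra.Properties.Ring ring
    using (-0#≈0#; -‿involutive; -‿distribˡ-*; -‿distribʳ-*; -‿+-comm)
  open import Algebra.Properties.Group +-group using (⁻¹-injective; x∙y⁻¹≈ε⇒x≈y)
  import Algebra.Properties.Semiring.Mult.TCOptimised semiring as Mult

  -- Equality in F is not decidable, so the ring solver works with integer coefficients,
  -- interpreted in F along the canonical map ℤ → F.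
  fromℕ : ℕ → Carrier
  fromℕ n = n Mult.× 1#

  fromℤ : ℤ → Carrier
  fromℤ (ℤ.+ n)  = fromℕ n
  fromℤ -[1+ n ] = - fromℕ (ℕ.suc n)

  fromℤ-⊖ : ∀ m n → fromℤ (m ℤ.⊖ n) ≡ fromℕ m - fromℕ n
  fromℤ-⊖ m         ℕ.zero    = sym (trans (cong (fromℕ m +_) -0#≈0#) (+-identityʳ _))
  fromℤ-⊖ ℕ.zero    (ℕ.suc n) = sym (+-identityˡ _)
  fromℤ-⊖ (ℕ.suc m) (ℕ.suc n) = begin
    fromℤ (ℕ.suc m ℤ.⊖ ℕ.suc n)          ≡⟨ cong fromℤ (ℤ.[1+m]⊖[1+n]≡m⊖n m n) ⟩
    fromℤ (m ℤ.⊖ n)                      ≡⟨ fromℤ-⊖ m n ⟩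
    fromℕ m + - fromℕ n
      ≡⟨ cong (fromℕ m +_) (sym (+-identityˡ _)) ⟩
    fromℕ m + (0# + - fromℕ n)
      ≡⟨ cong (λ t → fromℕ m + (t + - fromℕ n)) (sym (-‿inverseʳ 1#)) ⟩
    fromℕ m + ((1# + - 1#) + - fromℕ n)
      ≡⟨ cong (fromℕ m +_) (+-assoc 1# (- 1#) _) ⟩
    fromℕ m + (1# + (- 1# + - fromℕ n))
      ≡⟨ sym (+-assoc _ _ _) ⟩
    (fromℕ m + 1#) + (- 1# + - fromℕ n)
      ≡⟨ cong₂ _+_ (+-comm _ _) (-‿+-comm 1# (fromℕ n)) ⟩
    (1# + fromℕ m) + - (1# + fromℕ n)
      ≡⟨ sym (cong₂ (λ s t → s + - t) (Mult.1+× m 1#) (Mult.1+× n 1#)) ⟩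
    fromℕ (ℕ.suc m) - fromℕ (ℕ.suc n)
      ∎

  fromℤ-+ : ∀ i j → fromℤ (i ℤ.+ j) ≡ fromℤ i + fromℤ j
  fromℤ-+ (ℤ.+ m)  (ℤ.+ n)  = Mult.×-homo-+ 1# m n
  fromℤ-+ (ℤ.+ m)  -[1+ n ] = fromℤ-⊖ m (ℕ.suc n)
  fromℤ-+ -[1+ m ] (ℤ.+ n)  = trans (fromℤ-⊖ n (ℕ.suc m)) (+-comm _ _)
  fromℤ-+ -[1+ m ] -[1+ n ] = begin
    - fromℕ (ℕ.suc (ℕ.suc (m ℕ.+ n)))      ≡⟨ cong (λ k → - fromℕ (ℕ.suc k)) (sym (ℕ.+-suc m n)) ⟩
    - fromℕ (ℕ.suc m ℕ.+ ℕ.suc n)          ≡⟨ cong -_ (Mult.×-homo-+ 1# (ℕ.suc m) (ℕ.suc n)) ⟩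
    - (fromℕ (ℕ.suc m) + fromℕ (ℕ.suc n))  ≡⟨ sym (-‿+-comm _ _) ⟩
    - fromℕ (ℕ.suc m) + - fromℕ (ℕ.suc n)  ∎

  fromℤ-* : ∀ i j → fromℤ (i ℤ.* j) ≡ fromℤ i * fromℤ j
  fromℤ-* (ℤ.+ m)       (ℤ.+ n)       =
    trans (cong fromℤ (ℤ.+◃n≡+n (m ℕ.* n))) (Mult.×1-homo-* m n)
  fromℤ-* (ℤ.+ ℕ.zero)  -[1+ n ]      = sym (zeroˡ _)
  fromℤ-* (ℤ.+ ℕ.suc m) -[1+ n ]      =
    trans (cong -_ (Mult.×1-homo-* (ℕ.suc m) (ℕ.suc n))) (-‿distribʳ-* _ _)
  fromℤ-* -[1+ m ]      (ℤ.+ ℕ.zero)  = trans (cong fromℤ (ℤ.*-zeroʳ -[1+ m ])) (sym (zeroʳ _))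
  fromℤ-* -[1+ m ]      (ℤ.+ ℕ.suc n) =
    trans (cong -_ (Mult.×1-homo-* (ℕ.suc m) (ℕ.suc n))) (-‿distribˡ-* _ _)
  fromℤ-* -[1+ m ]      -[1+ n ]      = begin
    fromℕ (ℕ.suc m ℕ.* ℕ.suc n)              ≡⟨ Mult.×1-homo-* (ℕ.suc m) (ℕ.suc n) ⟩
    fromℕ (ℕ.suc m) * fromℕ (ℕ.suc n)        ≡⟨ sym (-‿involutive _) ⟩
    - - (fromℕ (ℕ.suc m) * fromℕ (ℕ.suc n))  ≡⟨ cong -_ (-‿distribˡ-* _ _) ⟩
    - (- fromℕ (ℕ.suc m) * fromℕ (ℕ.suc n))  ≡⟨ -‿distribʳ-* _ _ ⟩
    - fromℕ (ℕ.suc m) * - fromℕ (ℕ.suc n)    ∎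

  fromℤ-neg : ∀ i → fromℤ (ℤ.- i) ≡ - fromℤ i
  fromℤ-neg (ℤ.+ ℕ.zero)  = sym -0#≈0#
  fromℤ-neg (ℤ.+ ℕ.suc n) = refl
  fromℤ-neg -[1+ n ]      = sym (-‿involutive _)

  fromℤ-homomorphism : ℤ.+-*-rawRing -Raw-AlmostCommutative⟶ fromCommutativeRing commutativeRing
  fromℤ-homomorphism = record
    { ⟦_⟧    = fromℤ
    ; +-homo = fromℤ-+
    ; *-homo = fromℤ-*
    ; -‿homo = fromℤ-neg
    ; 0-homo = refl
    ; 1-homo = refl
    }

  fromℤ-≟ : ∀ i j → Maybe (fromℤ i ≡ fromℤ j)
  fromℤ-≟ i j with i ℤ.≟ j
  ... | yes i≡j = just (cong fromℤ i≡j)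
  ... | no _    = nothing

  open RingSolver ℤ.+-*-rawRing (fromCommutativeRing commutativeRing) fromℤ-homomorphism fromℤ-≟ public

  :0 :1 :2 : ∀ {k} → Polynomial k
  :0 = con (ℤ.+ 0)
  :1 = con (ℤ.+ 1)
  :2 = con (ℤ.+ 2)

  2# : Carrier
  2# = 1# + 1#

  x-y≡0⇒x≡y : ∀ {x y} → x - y ≡ 0# → x ≡ y
  x-y≡0⇒x≡y = x∙y⁻¹≈ε⇒x≈y _ _

  -x≡0⇒x≡0 : ∀ {x} → - x ≡ 0# → x ≡ 0#
  -x≡0⇒x≡0 -x≡0 = ⁻¹-injective (trans -x≡0 (sym -0#≈0#))

  x*y≡0⇒y≡0 : ∀ {x y} → x ≢ 0# → x * y ≡ 0# → y ≡ 0#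
  x*y≡0⇒y≡0 {x} {y} x≢0 xy≡0 with inverse x x≢0
  ... | x⁻¹ , xx⁻¹≡1 = begin
    y              ≡⟨ sym (*-identityˡ y) ⟩
    1# * y         ≡⟨ cong (_* y) (trans (sym xx⁻¹≡1) (*-comm x x⁻¹)) ⟩
    x⁻¹ * x * y    ≡⟨ *-assoc x⁻¹ x y ⟩
    x⁻¹ * (x * y)  ≡⟨ cong (x⁻¹ *_) xy≡0 ⟩
    x⁻¹ * 0#       ≡⟨ zeroʳ x⁻¹ ⟩
    0#             ∎

  x*y≢0 : ∀ {x y} → x ≢ 0# → y ≢ 0# → x * y ≢ 0#
  x*y≢0 x≢0 y≢0 xy≡0 = y≢0 (x*y≡0⇒y≡0 x≢0 xy≡0)

  x*x≡0⇒¬¬x≡0 : ∀ {x} → x * x ≡ 0# → ¬ ¬ x ≡ 0#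
  x*x≡0⇒¬¬x≡0 xx≡0 x≢0 = x*y≢0 x≢0 x≢0 xx≡0

  *-cancelʳ-≢0 : ∀ {x y z} → z ≢ 0# → x * z ≡ y * z → x ≡ y
  *-cancelʳ-≢0 {x} {y} {z} z≢0 xz≡yz = x-y≡0⇒x≡y (x*y≡0⇒y≡0 z≢0 (begin
    z * (x - y)    ≡⟨ solve 3 (λ x y z → z :* (x :- y) := x :* z :- y :* z) refl x y z ⟩
    x * z - y * z  ≡⟨ cong (_- y * z) xz≡yz ⟩
    y * z - y * z  ≡⟨ -‿inverseʳ (y * z) ⟩
    0#             ∎))

  2#≡0⇒x+2#*y≡x : 2# ≡ 0# → ∀ x y → x + 2# * y ≡ x
  2#≡0⇒x+2#*y≡x 2#≡0 x y =
    trans (cong (λ t → x + t * y) 2#≡0) (solve 2 (λ x y → x :+ :0 :* y := x) refl x y)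

module Forms {c : Level} (F : Field c) where
  open Field F
  open FieldDefs F
  open Scalars F
  open ≡-Reasoning
  open CommutativeRing commutativeRing
    using (+-comm; +-identityʳ; *-comm; *-assoc; *-identityˡ; zeroˡ; zeroʳ)

  x-y≈0⇒x≈y : ∀ {n} {x y : Vec n} → (x -ᵥ y) ≈ᵥ 0ᵥ → x ≈ᵥ y
  x-y≈0⇒x≈y x-y≈0 i = x-y≡0⇒x≡y (x-y≈0 i)

  x-y≈-1·[y-x] : ∀ {n} (x y : Vec n) → (x -ᵥ y) ≈ᵥ ((- 1#) · (y -ᵥ x))
  x-y≈-1·[y-x] x y i = solve 2 (λ x y → x :- y := :- :1 :* (y :- x)) refl (x i) (y i)

  x-y≈x+-1·y : ∀ {n} (x y : Vec n) → (x -ᵥ y) ≈ᵥ (x +ᵥ ((- 1#) · y))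
  x-y≈x+-1·y x y i = solve 2 (λ x y → x :- y := x :+ :- :1 :* y) refl (x i) (y i)

  [z-x]-[z-y]≈y-x : ∀ {n} (z x y : Vec n) → ((z -ᵥ x) -ᵥ (z -ᵥ y)) ≈ᵥ (y -ᵥ x)
  [z-x]-[z-y]≈y-x z x y i = solve 3 (λ z x y → (z :- x) :- (z :- y) := y :- x) refl (z i) (x i) (y i)

  [x-z]-[y-z]≈x-y : ∀ {n} (x y z : Vec n) → ((x -ᵥ z) -ᵥ (y -ᵥ z)) ≈ᵥ (x -ᵥ y)
  [x-z]-[y-z]≈x-y x y z i = solve 3 (λ x y z → (x :- z) :- (y :- z) := x :- y) refl (x i) (y i) (z i)

  lincomb : ∀ {n} → Vec n → Vec n → Vec 2 → Vec n
  lincomb x y v = (v 0F · x) +ᵥ (v 1F · y)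

  module QuadraticForm {n : ℕ} {q : Vec n → Carrier} (isQ : IsQuadraticForm q) where
    open IsQuadraticForm isQ renaming (cong to q-cong) public

    polar-cong : ∀ {x x' y y'} → x ≈ᵥ x' → y ≈ᵥ y' → polar q x y ≡ polar q x' y'
    polar-cong x≈x' y≈y' =
      cong₂ _-_ (cong₂ _-_ (q-cong (λ i → cong₂ _+_ (x≈x' i) (y≈y' i))) (q-cong x≈x')) (q-cong y≈y')

    polar-comm : ∀ x y → polar q x y ≡ polar q y x
    polar-comm x y = trans (cong (λ s → s - q x - q y) (q-cong (λ i → +-comm (x i) (y i))))
      (solve 3 (λ s X Y → s :- X :- Y := s :- Y :- X) refl (q (y +ᵥ x)) (q x) (q y))

    discriminant : Vec n → Vec n → Carrier
    discriminant x y = polar q x y * polar q x y - 2# * 2# * q x * q y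

    q-+ : ∀ x y → q (x +ᵥ y) ≡ q x + q y + polar q x y
    q-+ x y = solve 3 (λ s X Y → s := X :+ Y :+ (s :- X :- Y)) refl (q (x +ᵥ y)) (q x) (q y)

    q-lincomb : ∀ x y v →
      q (lincomb x y v) ≡ v 0F * v 0F * q x + v 1F * v 1F * q y + v 0F * (v 1F * polar q x y)
    q-lincomb x y v = trans (q-+ (v 0F · x) (v 1F · y))
      (cong₂ _+_ (cong₂ _+_ (homog (v 0F) x) (homog (v 1F) y))
                 (trans (bil-·ˡ (v 0F) x (v 1F · y)) (cong (v 0F *_) (bil-·ʳ (v 1F) x y))))

    q-neg : ∀ x → q ((- 1#) · x) ≡ q x
    q-neg x = trans (homog (- 1#) x) (solve 1 (λ X → :- :1 :* :- :1 :* X := X) refl (q x))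

    q-sub-comm : ∀ x y → q (x -ᵥ y) ≡ q (y -ᵥ x)
    q-sub-comm x y = trans (q-cong (x-y≈-1·[y-x] x y)) (q-neg (y -ᵥ x))

    q-sub : ∀ x y → q (x -ᵥ y) ≡ q x + q y - polar q x y
    q-sub x y = begin
      q (x -ᵥ y)
        ≡⟨ q-cong (x-y≈x+-1·y x y) ⟩
      q (x +ᵥ ((- 1#) · y))
        ≡⟨ q-+ x ((- 1#) · y) ⟩
      q x + q ((- 1#) · y) + polar q x ((- 1#) · y)
        ≡⟨ cong₂ (λ s t → q x + s + t) (q-neg y) (bil-·ʳ (- 1#) x y) ⟩
      q x + q y + - 1# * polar q x y
        ≡⟨ solve 3 (λ X Y P → X :+ Y :+ :- :1 :* P := X :+ Y :- P) refl (q x) (q y) (polar q x y) ⟩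
      q x + q y - polar q x y
        ∎

    polar-via-sub : ∀ x y → polar q x y ≡ q x + q y - q (x -ᵥ y)
    polar-via-sub x y = trans
      (solve 3 (λ X Y P → P := X :+ Y :- (X :+ Y :- P)) refl (q x) (q y) (polar q x y))
      (cong (λ t → q x + q y - t) (sym (q-sub x y)))

    polar-isosceles : ∀ {x y} → q (x -ᵥ y) ≡ q y → polar q x y ≡ q x
    polar-isosceles {x} {y} q[x-y]≡qy = trans (polar-via-sub x y)
      (trans (cong (λ t → q x + q y - t) q[x-y]≡qy) (solve 2 (λ X Y → X :+ Y :- Y := X) refl (q x) (q y)))

    polar-subˡ : ∀ x y z → polar q (x -ᵥ y) z ≡ polar q x z - polar q y z
    polar-subˡ x y z = begin
      polar q (x -ᵥ y) z                    ≡⟨ polar-cong (x-y≈x+-1·y x y) (λ _ → refl) ⟩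
      polar q (x +ᵥ ((- 1#) · y)) z         ≡⟨ bil-+ˡ x ((- 1#) · y) z ⟩
      polar q x z + polar q ((- 1#) · y) z  ≡⟨ cong (polar q x z +_) (bil-·ˡ (- 1#) y z) ⟩
      polar q x z + - 1# * polar q y z      ≡⟨ solve 2 (λ P Q → P :+ :- :1 :* Q := P :- Q) refl _ _ ⟩
      polar q x z - polar q y z             ∎

    polar-subʳ : ∀ x y z → polar q x (y -ᵥ z) ≡ polar q x y - polar q x z
    polar-subʳ x y z = trans (polar-comm x (y -ᵥ z))
      (trans (polar-subˡ y z x) (cong₂ _-_ (polar-comm y x) (polar-comm z x)))

    scaled-by-norms⇒≈ : ∀ {x y} → (q y · x) ≈ᵥ (q x · y) → q x ≢ 0# → q y ≢ 0# → x ≈ᵥ y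
    scaled-by-norms⇒≈ {x} {y} qy·x≈qx·y qx≢0 qy≢0 i = *-cancelʳ-≢0 qy≢0 (begin
      x i * q y  ≡⟨ *-comm (x i) (q y) ⟩
      q y * x i  ≡⟨ qy·x≈qx·y i ⟩
      q x * y i  ≡⟨ cong (_* y i) qx≡qy ⟩
      q y * y i  ≡⟨ *-comm (q y) (y i) ⟩
      y i * q y  ∎)
      where
      qx≡qy : q x ≡ q y
      qx≡qy = sym (x-y≡0⇒x≡y (x*y≡0⇒y≡0 (x*y≢0 qx≢0 qy≢0) (begin
        q x * q y * (q y - q x)
          ≡⟨ solve 2 (λ X Y → X :* Y :* (Y :- X) := Y :* Y :* X :- X :* X :* Y) refl (q x) (q y) ⟩
        q y * q y * q x - q x * q x * q y  ≡⟨ cong₂ _-_ (sym (homog (q y) x)) (sym (homog (q x) y)) ⟩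
        q (q y · x) - q (q x · y)          ≡⟨ cong (_- q (q x · y)) (q-cong qy·x≈qx·y) ⟩
        q (q x · y) - q (q x · y)          ≡⟨ solve 1 (λ X → X :- X := :0) refl _ ⟩
        0#                                 ∎)))

  -- Four points whose consecutive differences all have q-value a: a 4-cycle of 𝒢_{q,a}
  -- without the distinctness conditions.
  module Rhombus {n : ℕ} {q : Vec n → Carrier} (isQ : IsQuadraticForm q)
    {a : Carrier} {x₀ x₁ x₂ x₃ : Vec n}
    (side₀₁ : q (x₀ -ᵥ x₁) ≡ a) (side₁₂ : q (x₁ -ᵥ x₂) ≡ a)
    (side₂₃ : q (x₂ -ᵥ x₃) ≡ a) (side₃₀ : q (x₃ -ᵥ x₀) ≡ a) where
    open QuadraticForm isQ

    d₁ d₂ : Vec n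
    d₁ = x₂ -ᵥ x₀
    d₂ = x₃ -ᵥ x₁

    polar-side : ∀ {x y} → q (x -ᵥ y) ≡ a → polar q x y ≡ q x + q y - a
    polar-side {x} {y} side = trans (polar-via-sub x y) (cong (λ t → q x + q y - t) side)

    diagonals-orthogonal : polar q d₁ d₂ ≡ 0#
    diagonals-orthogonal = begin
      polar q (x₂ -ᵥ x₀) (x₃ -ᵥ x₁)
        ≡⟨ trans (polar-subˡ x₂ x₀ (x₃ -ᵥ x₁))
                 (cong₂ _-_ (polar-subʳ x₂ x₃ x₁) (polar-subʳ x₀ x₃ x₁)) ⟩
      (polar q x₂ x₃ - polar q x₂ x₁) - (polar q x₀ x₃ - polar q x₀ x₁)
        ≡⟨ cong₂ (λ s t → (polar q x₂ x₃ - s) - (t - polar q x₀ x₁))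
                 (polar-comm x₂ x₁) (polar-comm x₀ x₃) ⟩
      (polar q x₂ x₃ - polar q x₁ x₂) - (polar q x₃ x₀ - polar q x₀ x₁)
        ≡⟨ cong₂ _-_ (cong₂ _-_ (polar-side side₂₃) (polar-side side₁₂))
                     (cong₂ _-_ (polar-side side₃₀) (polar-side side₀₁)) ⟩
      ((q x₂ + q x₃ - a) - (q x₁ + q x₂ - a)) - ((q x₃ + q x₀ - a) - (q x₀ + q x₁ - a))
        ≡⟨ solve 5 (λ Q₀ Q₁ Q₂ Q₃ A →
             ((Q₂ :+ Q₃ :- A) :- (Q₁ :+ Q₂ :- A)) :- ((Q₃ :+ Q₀ :- A) :- (Q₀ :+ Q₁ :- A)) := :0)
             refl (q x₀) (q x₁) (q x₂) (q x₃) a ⟩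
      0#
        ∎

    side₂₁ : q (x₂ -ᵥ x₁) ≡ a
    side₂₁ = trans (q-sub-comm x₂ x₁) side₁₂

    polar-d₁-side₂₁ : polar q d₁ (x₂ -ᵥ x₁) ≡ q d₁
    polar-d₁-side₂₁ = polar-isosceles (begin
      q (d₁ -ᵥ (x₂ -ᵥ x₁))  ≡⟨ q-cong ([z-x]-[z-y]≈y-x x₂ x₀ x₁) ⟩
      q (x₁ -ᵥ x₀)          ≡⟨ q-sub-comm x₁ x₀ ⟩
      q (x₀ -ᵥ x₁)          ≡⟨ trans side₀₁ (sym side₂₁) ⟩
      q (x₂ -ᵥ x₁)          ∎)

    polar-d₂-side₂₁ : polar q d₂ (x₂ -ᵥ x₁) ≡ q d₂
    polar-d₂-side₂₁ = polar-isosceles (begin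
      q (d₂ -ᵥ (x₂ -ᵥ x₁))  ≡⟨ q-cong ([x-z]-[y-z]≈x-y x₃ x₂ x₁) ⟩
      q (x₃ -ᵥ x₂)          ≡⟨ q-sub-comm x₃ x₂ ⟩
      q (x₂ -ᵥ x₃)          ≡⟨ trans side₂₃ (sym side₂₁) ⟩
      q (x₂ -ᵥ x₁)          ∎)

  det : Vec 2 → Vec 2 → Carrier
  det x y = x 0F * y 1F - x 1F * y 0F

  det-cong : ∀ {x x' y y'} → x ≈ᵥ x' → y ≈ᵥ y' → det x y ≡ det x' y'
  det-cong x≈x' y≈y' = cong₂ _-_ (cong₂ _*_ (x≈x' 0F) (y≈y' 1F)) (cong₂ _*_ (x≈x' 1F) (y≈y' 0F))

  cramer : ∀ x y w → ((det w y · x) +ᵥ (det x w · y)) ≈ᵥ (det x y · w)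
  cramer x y w 0F = solve 6 (λ x₀ x₁ y₀ y₁ w₀ w₁ →
    (w₀ :* y₁ :- w₁ :* y₀) :* x₀ :+ (x₀ :* w₁ :- x₁ :* w₀) :* y₀ := (x₀ :* y₁ :- x₁ :* y₀) :* w₀)
    refl (x 0F) (x 1F) (y 0F) (y 1F) (w 0F) (w 1F)
  cramer x y w 1F = solve 6 (λ x₀ x₁ y₀ y₁ w₀ w₁ →
    (w₀ :* y₁ :- w₁ :* y₀) :* x₁ :+ (x₀ :* w₁ :- x₁ :* w₀) :* y₁ := (x₀ :* y₁ :- x₁ :* y₀) :* w₁)
    refl (x 0F) (x 1F) (y 0F) (y 1F) (w 0F) (w 1F)

  det≡0⇒parallel : ∀ {x y} → det x y ≡ 0# → ∀ z → (det y z · x) ≈ᵥ (det x z · y)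
  det≡0⇒parallel {x} {y} det≡0 z i = begin
    det y z * x i                  ≡⟨ sym (+-identityʳ _) ⟩
    det y z * x i + 0#             ≡⟨ cong (det y z * x i +_) (sym (trans (cong (_* z i) det≡0) (zeroˡ _))) ⟩
    det y z * x i + det x y * z i  ≡⟨ cramer x z y i ⟩
    det x z * y i                  ∎

  lincomb-isLinearIso : ∀ {x y} → det x y ≢ 0# → IsLinearIso (lincomb x y)
  lincomb-isLinearIso {x} {y} det≢0 = record
    { cong       = λ u≈v i → cong₂ (λ s t → s * x i + t * y i) (u≈v 0F) (u≈v 1F)
    ; additive   = λ u v i → solve 6 (λ u₀ u₁ v₀ v₁ X Y →
        (u₀ :+ v₀) :* X :+ (u₁ :+ v₁) :* Y := (u₀ :* X :+ u₁ :* Y) :+ (v₀ :* X :+ v₁ :* Y))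
        refl (u 0F) (u 1F) (v 0F) (v 1F) (x i) (y i)
    ; homogen    = λ s u i → solve 5 (λ s u₀ u₁ X Y →
        s :* u₀ :* X :+ s :* u₁ :* Y := s :* (u₀ :* X :+ u₁ :* Y))
        refl s (u 0F) (u 1F) (x i) (y i)
    ; injective  = injective
    ; surjective = λ w → (δ⁻¹ * det w y ∷ δ⁻¹ * det x w ∷ []) , solution w
    }
    where
    δ⁻¹ : Carrier
    δ⁻¹ = proj₁ (inverse (det x y) det≢0)

    δδ⁻¹≡1 : det x y * δ⁻¹ ≡ 1#
    δδ⁻¹≡1 = proj₂ (inverse (det x y) det≢0)

    det-lincombˡ : ∀ v → det (lincomb x y v) y ≡ v 0F * det x y
    det-lincombˡ v = solve 6 (λ v₀ v₁ x₀ x₁ y₀ y₁ →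
      (v₀ :* x₀ :+ v₁ :* y₀) :* y₁ :- (v₀ :* x₁ :+ v₁ :* y₁) :* y₀ := v₀ :* (x₀ :* y₁ :- x₁ :* y₀))
      refl (v 0F) (v 1F) (x 0F) (x 1F) (y 0F) (y 1F)

    det-lincombʳ : ∀ v → det x (lincomb x y v) ≡ v 1F * det x y
    det-lincombʳ v = solve 6 (λ v₀ v₁ x₀ x₁ y₀ y₁ →
      x₀ :* (v₀ :* x₁ :+ v₁ :* y₁) :- x₁ :* (v₀ :* x₀ :+ v₁ :* y₀) := v₁ :* (x₀ :* y₁ :- x₁ :* y₀))
      refl (v 0F) (v 1F) (x 0F) (x 1F) (y 0F) (y 1F)

    injective : ∀ u v → lincomb x y u ≈ᵥ lincomb x y v → u ≈ᵥ v
    injective u v fu≈fv 0F = *-cancelʳ-≢0 det≢0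
      (trans (sym (det-lincombˡ u)) (trans (det-cong {y = y} {y} fu≈fv (λ _ → refl)) (det-lincombˡ v)))
    injective u v fu≈fv 1F = *-cancelʳ-≢0 det≢0
      (trans (sym (det-lincombʳ u)) (trans (det-cong {x} {x} (λ _ → refl) fu≈fv) (det-lincombʳ v)))

    solution : ∀ w → lincomb x y (δ⁻¹ * det w y ∷ δ⁻¹ * det x w ∷ []) ≈ᵥ w
    solution w i = begin
      δ⁻¹ * det w y * x i + δ⁻¹ * det x w * y i
        ≡⟨ solve 5 (λ d D₁ D₂ X Y → d :* D₁ :* X :+ d :* D₂ :* Y := d :* (D₁ :* X :+ D₂ :* Y))
             refl δ⁻¹ (det w y) (det x w) (x i) (y i) ⟩
      δ⁻¹ * (det w y * x i + det x w * y i)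
        ≡⟨ cong (δ⁻¹ *_) (cramer x y w i) ⟩
      δ⁻¹ * (det x y * w i)
        ≡⟨ solve 3 (λ d D W → d :* (D :* W) := D :* d :* W) refl δ⁻¹ (det x y) (w i) ⟩
      det x y * δ⁻¹ * w i
        ≡⟨ cong (_* w i) δδ⁻¹≡1 ⟩
      1# * w i
        ≡⟨ *-identityˡ (w i) ⟩
      w i
        ∎

  binary : Carrier → Carrier → Carrier → Carrier → Carrier → Carrier
  binary A B C s t = A * (s * s) + B * (s * t) + C * (t * t)

  :binary : ∀ {k} → (A B C s t : Polynomial k) → Polynomial k
  :binary A B C s t = A :* (s :* s) :+ B :* (s :* t) :+ C :* (t :* t)

  module BinaryForm {q : Vec 2 → Carrier} (isQ : IsQuadraticForm q) where
    open QuadraticForm isQ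

    e₀ e₁ : Vec 2
    e₀ = 1# ∷ 0# ∷ []
    e₁ = 0# ∷ 1# ∷ []

    A B C : Carrier
    A = q e₀
    B = polar q e₀ e₁
    C = q e₁

    q-coords : ∀ v → q v ≡ binary A B C (v 0F) (v 1F)
    q-coords v = trans (q-cong v≈v₀e₀+v₁e₁) (trans (q-lincomb e₀ e₁ v)
      (solve 5 (λ v₀ v₁ A B C → v₀ :* v₀ :* A :+ v₁ :* v₁ :* C :+ v₀ :* (v₁ :* B) := :binary A B C v₀ v₁)
        refl (v 0F) (v 1F) A B C))
      where
      v≈v₀e₀+v₁e₁ : v ≈ᵥ lincomb e₀ e₁ v
      v≈v₀e₀+v₁e₁ 0F = solve 2 (λ v₀ v₁ → v₀ := v₀ :* :1 :+ v₁ :* :0) refl (v 0F) (v 1F)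
      v≈v₀e₀+v₁e₁ 1F = solve 2 (λ v₀ v₁ → v₁ := v₀ :* :0 :+ v₁ :* :1) refl (v 0F) (v 1F)

    polar-coords : ∀ x y → polar q x y ≡
      binary A B C (x 0F + y 0F) (x 1F + y 1F) - binary A B C (x 0F) (x 1F) - binary A B C (y 0F) (y 1F)
    polar-coords x y = cong₂ _-_ (cong₂ _-_ (q-coords (x +ᵥ y)) (q-coords x)) (q-coords y)

    discriminant-det : ∀ x y → discriminant x y ≡ det x y * det x y * discriminant e₀ e₁
    discriminant-det x y = trans
      (cong₂ (λ P Q → P * P - Q) (polar-coords x y)
             (cong₂ (λ X Y → 2# * 2# * X * Y) (q-coords x) (q-coords y)))
      (solve 7 (λ A B C x₀ x₁ y₀ y₁ →
        let P = :binary A B C (x₀ :+ y₀) (x₁ :+ y₁) :- :binary A B C x₀ x₁ :- :binary A B C y₀ y₁ in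
        P :* P :- :2 :* :2 :* :binary A B C x₀ x₁ :* :binary A B C y₀ y₁
          := (x₀ :* y₁ :- x₁ :* y₀) :* (x₀ :* y₁ :- x₁ :* y₀) :* (B :* B :- :2 :* :2 :* A :* C))
        refl A B C (x 0F) (x 1F) (y 0F) (y 1F))

    -- If B² = 4AC then (B, -2A) is in the radical, so B = 2A = 0 and e₀ is in the radical.
    discriminant-e≢0 : NonDegenerate q → discriminant e₀ e₁ ≢ 0#
    discriminant-e≢0 nondeg disc≡0 = 0≢1 (sym (e₀≈0 0F))
      where
      r : Vec 2
      r = B ∷ - (2# * A) ∷ []

      r≈0 : r ≈ᵥ 0ᵥ
      r≈0 = nondeg r (λ y → begin
        polar q r y
          ≡⟨ polar-coords r y ⟩
        _ ≡⟨ solve 5 (λ A B C y₀ y₁ →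
               :binary A B C (B :+ y₀) (:- (:2 :* A) :+ y₁) :- :binary A B C B (:- (:2 :* A))
                 :- :binary A B C y₀ y₁
                 := (B :* B :- :2 :* :2 :* A :* C) :* y₁) refl A B C (y 0F) (y 1F) ⟩
        discriminant e₀ e₁ * y 1F  ≡⟨ cong (_* y 1F) disc≡0 ⟩
        0# * y 1F                  ≡⟨ zeroˡ (y 1F) ⟩
        0#                         ∎)

      e₀≈0 : e₀ ≈ᵥ 0ᵥ
      e₀≈0 = nondeg e₀ (λ y → begin
        polar q e₀ y
          ≡⟨ polar-coords e₀ y ⟩
        _ ≡⟨ solve 5 (λ A B C y₀ y₁ →
               :binary A B C (:1 :+ y₀) (:0 :+ y₁) :- :binary A B C :1 :0 :- :binary A B C y₀ y₁
                 := :2 :* A :* y₀ :+ B :* y₁) refl A B C (y 0F) (y 1F) ⟩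
        2# * A * y 0F + B * y 1F
          ≡⟨ cong₂ (λ s t → s * y 0F + t * y 1F) (-x≡0⇒x≡0 (r≈0 1F)) (r≈0 0F) ⟩
        0# * y 0F + 0# * y 1F
          ≡⟨ solve 2 (λ y₀ y₁ → :0 :* y₀ :+ :0 :* y₁ := :0) refl (y 0F) (y 1F) ⟩
        0#
          ∎)

    det≢0⇒discriminant≢0 : NonDegenerate q → ∀ {x y} → det x y ≢ 0# → discriminant x y ≢ 0#
    det≢0⇒discriminant≢0 nondeg {x} {y} det≢0 disc≡0 =
      x*y≢0 (x*y≢0 det≢0 det≢0) (discriminant-e≢0 nondeg) (trans (sym (discriminant-det x y)) disc≡0)

    -- Only ¬ ¬ w ≈ᵥ 0ᵥ: a vanishing square does not constructively give a vanishing scalar.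
    parallel-isotropic⇒¬¬≈0 : ∀ {u w} → det u w ≡ 0# → q u ≢ 0# → q w ≡ 0# → ¬ ¬ w ≈ᵥ 0ᵥ
    parallel-isotropic⇒¬¬≈0 {u} {w} det≡0 qu≢0 qw≡0 w≉0 =
      x*x≡0⇒¬¬x≡0 w₀²≡0 (λ w₀≡0 → x*x≡0⇒¬¬x≡0 w₁²≡0 (λ w₁≡0 → w≉0 (λ { 0F → w₀≡0 ; 1F → w₁≡0 })))
      where
      det²≡0 : ∀ z → det w z * det w z ≡ 0#
      det²≡0 z = x*y≡0⇒y≡0 qu≢0 (begin
        q u * (det w z * det w z)  ≡⟨ *-comm (q u) _ ⟩
        det w z * det w z * q u    ≡⟨ sym (homog (det w z) u) ⟩
        q (det w z · u)            ≡⟨ q-cong (det≡0⇒parallel det≡0 z) ⟩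
        q (det u z · w)            ≡⟨ homog (det u z) w ⟩
        det u z * det u z * q w    ≡⟨ cong (det u z * det u z *_) qw≡0 ⟩
        det u z * det u z * 0#     ≡⟨ zeroʳ _ ⟩
        0#                         ∎)

      w₀²≡0 : w 0F * w 0F ≡ 0#
      w₀²≡0 = trans (solve 2 (λ w₀ w₁ → w₀ :* w₀ := (w₀ :* :1 :- w₁ :* :0) :* (w₀ :* :1 :- w₁ :* :0))
        refl (w 0F) (w 1F)) (det²≡0 e₁)

      w₁²≡0 : w 1F * w 1F ≡ 0#
      w₁²≡0 = trans (solve 2 (λ w₀ w₁ → w₁ :* w₁ := (w₀ :* :0 :- w₁ :* :1) :* (w₀ :* :0 :- w₁ :* :1))
        refl (w 0F) (w 1F)) (det²≡0 e₀)

    orthogonal-isotropic⇒¬¬≈0 : NonDegenerate q → ∀ {u w} →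
      q u ≢ 0# → q w ≡ 0# → polar q u w ≡ 0# → ¬ ¬ w ≈ᵥ 0ᵥ
    orthogonal-isotropic⇒¬¬≈0 nondeg {u} {w} qu≢0 qw≡0 b≡0 w≉0 =
      det≢0⇒discriminant≢0 nondeg (λ det≡0 → parallel-isotropic⇒¬¬≈0 det≡0 qu≢0 qw≡0 w≉0) (begin
        polar q u w * polar q u w - 2# * 2# * q u * q w
          ≡⟨ cong₂ (λ P Q → P * P - 2# * 2# * q u * Q) b≡0 qw≡0 ⟩
        0# * 0# - 2# * 2# * q u * 0#
          ≡⟨ solve 1 (λ U → :0 :* :0 :- :2 :* :2 :* U :* :0 := :0) refl (q u) ⟩
        0#
          ∎)

    triangle-diagonal-anisotropic : NonDegenerate q → ∀ {a x y z} → a ≢ 0# →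
      q (x -ᵥ y) ≡ a → q (y -ᵥ z) ≡ a → ¬ x ≈ᵥ z → q (z -ᵥ x) ≢ 0#
    triangle-diagonal-anisotropic nondeg {a} {x} {y} {z} a≢0 qxy≡a qyz≡a x≉z qzx≡0 =
      orthogonal-isotropic⇒¬¬≈0 nondeg (λ qxy≡0 → a≢0 (trans (sym qxy≡a) qxy≡0)) qxz≡0 b≡0
        (λ x-z≈0 → x≉z (x-y≈0⇒x≈y x-z≈0))
      where
      qxz≡0 : q (x -ᵥ z) ≡ 0#
      qxz≡0 = trans (q-sub-comm x z) qzx≡0

      b≡0 : polar q (x -ᵥ y) (x -ᵥ z) ≡ 0#
      b≡0 = begin
        polar q (x -ᵥ y) (x -ᵥ z)
          ≡⟨ polar-comm _ _ ⟩
        polar q (x -ᵥ z) (x -ᵥ y)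
          ≡⟨ polar-via-sub _ _ ⟩
        q (x -ᵥ z) + q (x -ᵥ y) - q ((x -ᵥ z) -ᵥ (x -ᵥ y))
          ≡⟨ cong₂ _-_ (cong₂ _+_ qxz≡0 qxy≡a) (trans (q-cong ([z-x]-[z-y]≈y-x x z y)) qyz≡a) ⟩
        0# + a - a
          ≡⟨ solve 1 (λ a → :0 :+ a :- a := :0) refl a ⟩
        0#
          ∎

    orthogonal-anisotropic⇒det≢0 : 2# ≢ 0# → ∀ {x y} →
      polar q x y ≡ 0# → q x ≢ 0# → q y ≢ 0# → det x y ≢ 0#
    orthogonal-anisotropic⇒det≢0 2#≢0 {x} {y} b≡0 qx≢0 qy≢0 det≡0 =
      x*y≢0 (x*y≢0 (x*y≢0 2#≢0 2#≢0) qx≢0) qy≢0 (-x≡0⇒x≡0 (begin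
        - (2# * 2# * q x * q y)
          ≡⟨ solve 2 (λ X Y → :- (:2 :* :2 :* X :* Y) := :0 :* :0 :- :2 :* :2 :* X :* Y) refl (q x) (q y) ⟩
        0# * 0# - 2# * 2# * q x * q y
          ≡⟨ cong (λ P → P * P - 2# * 2# * q x * q y) (sym b≡0) ⟩
        discriminant x y
          ≡⟨ discriminant-det x y ⟩
        det x y * det x y * discriminant e₀ e₁
          ≡⟨ cong (λ D → D * D * discriminant e₀ e₁) det≡0 ⟩
        0# * 0# * discriminant e₀ e₁
          ≡⟨ solve 1 (λ D → :0 :* :0 :* D := :0) refl _ ⟩
        0#
          ∎))

    orthogonal-basis-isometric : ∀ {x y} → polar q x y ≡ 0# → det x y ≢ 0# →
      Isometric q (diag2 (q x) (q y))
    orthogonal-basis-isometric {x} {y} b≡0 det≢0 = lincomb x y , lincomb-isLinearIso det≢0 , λ v → begin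
      q (lincomb x y v)
        ≡⟨ q-lincomb x y v ⟩
      v 0F * v 0F * q x + v 1F * v 1F * q y + v 0F * (v 1F * polar q x y)
        ≡⟨ cong (λ P → v 0F * v 0F * q x + v 1F * v 1F * q y + v 0F * (v 1F * P)) b≡0 ⟩
      v 0F * v 0F * q x + v 1F * v 1F * q y + v 0F * (v 1F * 0#)
        ≡⟨ solve 4 (λ v₀ v₁ X Y →
             v₀ :* v₀ :* X :+ v₁ :* v₁ :* Y :+ v₀ :* (v₁ :* :0) := X :* (v₀ :* v₀) :+ Y :* (v₁ :* v₁))
             refl (v 0F) (v 1F) (q x) (q y) ⟩
      q x * (v 0F * v 0F) + q y * (v 1F * v 1F)
        ∎

    polar≡B*det : 2# ≡ 0# → ∀ x y → polar q x y ≡ B * det x y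
    polar≡B*det 2#≡0 x y = begin
      polar q x y
        ≡⟨ polar-coords x y ⟩
      _ ≡⟨ solve 7 (λ A B C x₀ x₁ y₀ y₁ →
             :binary A B C (x₀ :+ y₀) (x₁ :+ y₁) :- :binary A B C x₀ x₁ :- :binary A B C y₀ y₁
               := B :* (x₀ :* y₁ :- x₁ :* y₀) :+ :2 :* (A :* x₀ :* y₀ :+ B :* x₁ :* y₀ :+ C :* x₁ :* y₁))
             refl A B C (x 0F) (x 1F) (y 0F) (y 1F) ⟩
      B * det x y + 2# * (A * x 0F * y 0F + B * x 1F * y 0F + C * x 1F * y 1F)
        ≡⟨ 2#≡0⇒x+2#*y≡x 2#≡0 _ _ ⟩
      B * det x y
        ∎

    B≢0 : NonDegenerate q → 2# ≡ 0# → B ≢ 0#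
    B≢0 nondeg 2#≡0 B≡0 = discriminant-e≢0 nondeg (begin
      B * B - 2# * 2# * A * C
        ≡⟨ solve 3 (λ A B C → B :* B :- :2 :* :2 :* A :* C := B :* B :+ :2 :* (:- (:2 :* A :* C)))
             refl A B C ⟩
      B * B + 2# * - (2# * A * C)  ≡⟨ 2#≡0⇒x+2#*y≡x 2#≡0 _ _ ⟩
      B * B                        ≡⟨ cong (λ b → b * b) B≡0 ⟩
      0# * 0#                      ≡⟨ zeroˡ 0# ⟩
      0#                           ∎)

    orthogonal⇒polar-parallel : NonDegenerate q → 2# ≡ 0# → ∀ {x y} → polar q x y ≡ 0# →
      ∀ z → (polar q y z · x) ≈ᵥ (polar q x z · y)
    orthogonal⇒polar-parallel nondeg 2#≡0 {x} {y} b≡0 z i = begin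
      polar q y z * x i    ≡⟨ cong (_* x i) (polar≡B*det 2#≡0 y z) ⟩
      B * det y z * x i    ≡⟨ *-assoc B _ _ ⟩
      B * (det y z * x i)  ≡⟨ cong (B *_) (det≡0⇒parallel {x} {y} det≡0 z i) ⟩
      B * (det x z * y i)  ≡⟨ sym (*-assoc B _ _) ⟩
      B * det x z * y i    ≡⟨ cong (_* y i) (sym (polar≡B*det 2#≡0 x z)) ⟩
      polar q x z * y i    ∎
      where
      det≡0 : det x y ≡ 0#
      det≡0 = x*y≡0⇒y≡0 (B≢0 nondeg 2#≡0) (trans (sym (polar≡B*det 2#≡0 x y)) b≡0)

  module PlaneRhombus {q : Vec 2 → Carrier} (isQ : IsQuadraticForm q) (nondeg : NonDegenerate q)
    {a : Carrier} (a≢0 : a ≢ 0#) {x₀ x₁ x₂ x₃ : Vec 2} (x₀≉x₂ : ¬ x₀ ≈ᵥ x₂) (x₁≉x₃ : ¬ x₁ ≈ᵥ x₃)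
    (side₀₁ : q (x₀ -ᵥ x₁) ≡ a) (side₁₂ : q (x₁ -ᵥ x₂) ≡ a)
    (side₂₃ : q (x₂ -ᵥ x₃) ≡ a) (side₃₀ : q (x₃ -ᵥ x₀) ≡ a) where
    open QuadraticForm isQ
    open BinaryForm isQ
    open Rhombus isQ side₀₁ side₁₂ side₂₃ side₃₀

    qd₁≢0 : q d₁ ≢ 0#
    qd₁≢0 = triangle-diagonal-anisotropic nondeg a≢0 side₀₁ side₁₂ x₀≉x₂

    qd₂≢0 : q d₂ ≢ 0#
    qd₂≢0 = triangle-diagonal-anisotropic nondeg a≢0 side₁₂ side₂₃ x₁≉x₃

    isometric-to-diagonals : 2# ≢ 0# → Isometric q (diag2 (q d₁) (q d₂))
    isometric-to-diagonals 2#≢0 = orthogonal-basis-isometric diagonals-orthogonal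
      (orthogonal-anisotropic⇒det≢0 2#≢0 diagonals-orthogonal qd₁≢0 qd₂≢0)

    diagonals-equal : 2# ≡ 0# → d₁ ≈ᵥ d₂
    diagonals-equal 2#≡0 = scaled-by-norms⇒≈ qd₂·d₁≈qd₁·d₂ qd₁≢0 qd₂≢0
      where
      qd₂·d₁≈qd₁·d₂ : (q d₂ · d₁) ≈ᵥ (q d₁ · d₂)
      qd₂·d₁≈qd₁·d₂ i = begin
        q d₂ * d₁ i
          ≡⟨ cong (_* d₁ i) (sym polar-d₂-side₂₁) ⟩
        polar q d₂ (x₂ -ᵥ x₁) * d₁ i
          ≡⟨ orthogonal⇒polar-parallel nondeg 2#≡0 diagonals-orthogonal (x₂ -ᵥ x₁) i ⟩
        polar q d₁ (x₂ -ᵥ x₁) * d₂ i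
          ≡⟨ cong (_* d₂ i) polar-d₁-side₂₁ ⟩
        q d₁ * d₂ i
          ∎

open FieldDefs

proposition4p8 : ∀ {c : Level} (F : Field c) →
    (∀ (n : ℕ) → 2 ≤ n → (q : Vec F n → Field.Carrier F) →
    IsQuadraticForm F q → NonDegenerate F q →
    ∀ (a : Field.Carrier F) (x₀ x₁ x₂ x₃ : Vec F n) →
    IsCycle4 F q a x₀ x₁ x₂ x₃ →
    polar F q (_-ᵥ_ F x₂ x₀) (_-ᵥ_ F x₃ x₁) ≡ Field.0# F)
    ×
    (∀ (q : Vec F 2 → Field.Carrier F) →
    IsQuadraticForm F q → NonDegenerate F q →
    ∀ (a : Field.Carrier F) → a ≢ Field.0# F → (x₀ x₁ x₂ x₃ : Vec F 2) →
    IsCycle4 F q a x₀ x₁ x₂ x₃ →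
    ((Field._+_ F (Field.1# F) (Field.1# F) ≢ Field.0# F →
    Isometric F q (diag2 F (q (_-ᵥ_ F x₂ x₀)) (q (_-ᵥ_ F x₃ x₁))))
    ×
    (Field._+_ F (Field.1# F) (Field.1# F) ≡ Field.0# F →
    _≈ᵥ_ F (_-ᵥ_ F x₂ x₀) (_-ᵥ_ F x₃ x₁))))
proposition4p8 F =
    (λ { _ _ q isQ _ a x₀ x₁ x₂ x₃
         (_ , _ , _ , _ , _ , _ , (_ , s₀₁) , (_ , s₁₂) , (_ , s₂₃) , (_ , s₃₀)) →
           Rhombus.diagonals-orthogonal isQ s₀₁ s₁₂ s₂₃ s₃₀ })
  , (λ { q isQ nondeg a a≢0 x₀ x₁ x₂ x₃
         (_ , x₀≉x₂ , _ , _ , x₁≉x₃ , _ , (_ , s₀₁) , (_ , s₁₂) , (_ , s₂₃) , (_ , s₃₀)) →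
           let open PlaneRhombus isQ nondeg a≢0 x₀≉x₂ x₁≉x₃ s₀₁ s₁₂ s₂₃ s₃₀
           in isometric-to-diagonals , diagonals-equal })
  where open Forms F
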